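{- For any context $\Gamma=(G,H)$ (as defined below), if a derivation in the range analysis calculus starting from $\Gamma$ reaches a context whose set of goals is empty, then every goal in $G$ holds under the hypotheses $H$, i.e. $H\models\gamma$ for all $\gamma\in G$.
   Context: Setting: formulas over sorts $\mathbb{F}_P$ ($P$ prime), $\mathbb{N}$ (with $+,\cdot$, truncated $-$, $\bmod$, $\le,\ge$, $\max$), $\mathrm{BV}_N$ and $\mathrm{Bool}$, with $\mathtt{ite}$ and conversions $\texttt{toNat}:\mathbb{F}_P\to\mathbb{N}$ (representative in $[0,P-1]$) and $\texttt{bvToNat}:\mathrm{BV}_N\to\mathbb{N}$. A context is $\Gamma=(G,H)$ with $G$ a finite set of goals ($\mathbb{N}$-inequalities) and $H$ a finite set of hypotheses; only $G$ is modified. Original variables are those occurring in $\Gamma$ before range analysis starts; placeholder variables $w,w_i$ are fresh variables introduced by the rules, implicitly existentially quantified over the whole goal set (the goal set means: there exist values of the placeholders making all goals true). $\mathrm{HasVars}(t)$ holds iff $t$ contains at least one variable and no placeholder variable; $\mathrm{twoOrigVars}(t)$ iff $t$ contains exactly two distinct non-placeholder variables; $\mathrm{hasSub}(t)$ iff $t$ contains $-_{\mathbb{N}}$. "Instantiate $w:=C$ using $\gamma$" means $G:=(G\setminus\{\gamma'\in G: w\text{ occurs in }\gamma'\})\cup\{\gamma'[w/C]:\gamma'\in G\setminus\{\gamma\}\}$. Rules ($t_i:\mathbb{N}$, $\gamma\in G$): introPVar: $\gamma\equiv t_1\bowtie t_2$, $\bowtie\in\{\le,\ge\}$, $\mathrm{HasVars}(t_1\bowtie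 t_2)$: replace $\gamma$ by $t_1\bowtie w$ and $t_2\bowtie' w$, $\bowtie'$ the other relation of $\{\le,\ge\}$. leqAddMul: $\gamma\equiv t_1\bowtie t_2\le w$, $\bowtie\in\{+,\cdot\}$, $\mathrm{HasVars}(t_1\bowtie t_2)$: replace by $t_1\le w_1$, $t_2\le w_2$, $w_1\bowtie w_2\le w$. leqSub: $\gamma\equiv t_1-t_2\le w$, $\mathrm{HasVars}(t_1-t_2)$: replace by $t_1\le w$. leqMod: $\gamma\equiv t_1\bmod t_2\le w$, $\mathrm{HasVars}(t_1\bmod t_2)$: replace by $t_2\le w$. leqIf: $\gamma\equiv\mathtt{ite}(c,t_1,t_2)\le w$, $\mathrm{HasVars}(t_1)$, $\mathrm{HasVars}(t_2)$: replace by $t_1\le w_1$, $t_2\le w_2$, $\max(w_1,w_2)\le w$. ineqHyp: $\gamma\equiv t_1\bowtie w$, $\bowtie\in\{\le,\ge\}$, $\mathrm{HasVars}(t_1)$, $t_1\bowtie C\in H$ for a constant $C$: instantiate $w:=C$. leqZMod: $\gamma\equiv\texttt{toNat}(v)\le w$, $v:\mathbb{F}_P$ not a placeholder: instantiate $w:=P-1$. leqBV: $\gamma\equiv\texttt{bvToNat}(v)\le w$, $v:\mathrm{BV}_N$ not a placeholder: instantiate $w:=2^N-1$. geNat: $\gamma\equiv t_1\ge w$, $\mathrm{HasVars}(t_1)$: instantiate $w:=0$. ineqConst: $\gamma\equiv C\bowtie w$, $C$ constant, and every $\gamma'\in G$ either does not contain $w$ or contains no original variable: instantiate $w:=C$.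 eval: $\gamma\equiv C_1\le C_2$ with constants: replace $\gamma$ by its evaluation (a true goal is thereby discharged). ineqCases: $\gamma\equiv t_1\bowtie t_2$, $\mathrm{twoOrigVars}(\gamma)$ with original variables $v_1,v_2$, $\mathrm{hasSub}(\gamma)$ or ($\mathrm{HasVars}(t_1)$ and $\mathrm{HasVars}(t_2)$), $v_1\le1\in H$, $v_2\le1\in H$: replace $\gamma$ by $\gamma[v_1,v_2/a,b]$ for all $(a,b)\in\{0,1\}^2$. ineqXOR: $\gamma\equiv v_1\cdot t_1+(1-v_1)\cdot t_2\bowtie w$, $\bowtie\in\{\le,\ge\}$, $v_1\le1\in H$: replace by $\mathtt{ite}(v_1=0,t_2,t_1)\bowtie w$. -}

module Defs where

open import Data.Nat using (ℕ; zero; suc; _+_; _*_; _∸_; _^_; _≤_; _≥_; _≡ᵇ_; _⊔_)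
open import Data.Nat.DivMod using (_%_; _mod_)
open import Data.Nat.Primality using (Prime)
open import Data.Fin using (Fin; toℕ)
open import Data.Bool using (Bool; true; false; if_then_else_; not; _∧_; _∨_)
open import Data.List using (List; []; _∷_; _++_)
open import Data.List.Membership.Propositional using (_∈_; _∉_)
open import Data.Product using (Σ; _×_; _,_; ∃-syntax)
open import Data.Sum using (_⊎_)
open import Relation.Nullary using (¬_)
open import Relation.Binary.PropositionalEquality using (_≡_; _≢_)
open import Function.Bundles using (_⇔_)

data Sort : Set where
  fp   : (P : ℕ) → Prime P → Sort
  nat  : Sort
  bv   : (N : ℕ) → Sort
  bool : Sort

-- Terms (formulas are terms of sort bool).
-- `var s i` : original variable number i of sort s
-- `pv w`    : placeholder variable number w (placeholders are of sort ℕ)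

data Term : Sort → Set where
  var     : (s : Sort) → ℕ → Term s
  pv      : ℕ → Term nat
  ite     : ∀ {s} → Term bool → Term s → Term s → Term s
  lit     : ℕ → Term nat
  plus    : Term nat → Term nat → Term nat
  times   : Term nat → Term nat → Term nat
  minus   : Term nat → Term nat → Term nat      -- truncated subtraction
  modT    : Term nat → Term nat → Term nat
  maxT    : Term nat → Term nat → Term nat
  toNat   : ∀ {P pr} → Term (fp P pr) → Term nat
  bvToNat : ∀ {N} → Term (bv N) → Term nat
  fpLit   : ∀ {P pr} → Fin P → Term (fp P pr)
  fpAdd   : ∀ {P pr} → Term (fp P pr) → Term (fp P pr) → Term (fp P pr)
  fpMul   : ∀ {P pr} → Term (fp P pr) → Term (fp P pr) → Term (fp P pr)
  bvLit   : ∀ {N} → Fin (2 ^ N) → Term (bv N)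
  bvAdd   : ∀ {N} → Term (bv N) → Term (bv N) → Term (bv N)
  bvMul   : ∀ {N} → Term (bv N) → Term (bv N) → Term (bv N)
  tt ff   : Term bool
  notT    : Term bool → Term bool
  andT    : Term bool → Term bool → Term bool
  orT     : Term bool → Term bool → Term bool
  eqT     : ∀ {s} → Term s → Term s → Term bool
  leqT    : Term nat → Term nat → Term bool
  geqT    : Term nat → Term nat → Term bool

⟦_⟧ˢ : Sort → Set
⟦ fp P _ ⟧ˢ = Fin P
⟦ nat ⟧ˢ    = ℕ
⟦ bv N ⟧ˢ   = Fin (2 ^ N)
⟦ bool ⟧ˢ   = Bool

-- modular arithmetic on Fin n (the argument witnesses n ≠ 0)
addF : ∀ {n} → Fin n → Fin n → Fin n
addF {suc k} a b = (toℕ a + toℕ b) mod suc k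

mulF : ∀ {n} → Fin n → Fin n → Fin n
mulF {suc k} a b = (toℕ a * toℕ b) mod suc k

-- ℕ modulo, with the convention  m mod 0 = 0
modℕ : ℕ → ℕ → ℕ
modℕ m zero    = 0
modℕ m (suc k) = m % suc k

eqˢ : (s : Sort) → ⟦ s ⟧ˢ → ⟦ s ⟧ˢ → Bool
eqˢ (fp P _) a b = toℕ a ≡ᵇ toℕ b
eqˢ nat a b      = a ≡ᵇ b
eqˢ (bv N) a b   = toℕ a ≡ᵇ toℕ b
eqˢ bool a b     = if a then b else not b

leqᵇ : ℕ → ℕ → Bool
leqᵇ zero n          = true
leqᵇ (suc m) zero    = false
leqᵇ (suc m) (suc n) = leqᵇ m n

Val : Set
Val = (s : Sort) → ℕ → ⟦ s ⟧ˢ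

PVal : Set
PVal = ℕ → ℕ

eval : ∀ {s} → Val → PVal → Term s → ⟦ s ⟧ˢ
eval ρ π (var s i)     = ρ s i
eval ρ π (pv w)        = π w
eval ρ π (ite c a b)   = if eval ρ π c then eval ρ π a else eval ρ π b
eval ρ π (lit n)       = n
eval ρ π (plus a b)    = eval ρ π a + eval ρ π b
eval ρ π (times a b)   = eval ρ π a * eval ρ π b
eval ρ π (minus a b)   = eval ρ π a ∸ eval ρ π b
eval ρ π (modT a b)    = modℕ (eval ρ π a) (eval ρ π b)
eval ρ π (maxT a b)    = eval ρ π a ⊔ eval ρ π b
eval ρ π (toNat a)     = toℕ (eval ρ π a)
eval ρ π (bvToNat a)   = toℕ (eval ρ π a)
eval ρ π (fpLit x)     = x
eval ρ π (fpAdd a b)   = addF (eval ρ π a) (eval ρ π b)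
eval ρ π (fpMul a b)   = mulF (eval ρ π a) (eval ρ π b)
eval ρ π (bvLit x)     = x
eval ρ π (bvAdd a b)   = addF (eval ρ π a) (eval ρ π b)
eval ρ π (bvMul a b)   = mulF (eval ρ π a) (eval ρ π b)
eval ρ π tt            = true
eval ρ π ff            = false
eval ρ π (notT a)      = not (eval ρ π a)
eval ρ π (andT a b)    = eval ρ π a ∧ eval ρ π b
eval ρ π (orT a b)     = eval ρ π a ∨ eval ρ π b
eval ρ π (eqT {s} a b) = eqˢ s (eval ρ π a) (eval ρ π b)
eval ρ π (leqT a b)    = leqᵇ (eval ρ π a) (eval ρ π b)
eval ρ π (geqT a b)    = leqᵇ (eval ρ π b) (eval ρ π a)

OVar : Set
OVar = Σ Sort (λ _ → ℕ)

ovars : ∀ {s} → Term s → List OVar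
ovars (var s i)   = (s , i) ∷ []
ovars (pv w)      = []
ovars (ite c a b) = ovars c ++ ovars a ++ ovars b
ovars (lit n)     = []
ovars (plus a b)  = ovars a ++ ovars b
ovars (times a b) = ovars a ++ ovars b
ovars (minus a b) = ovars a ++ ovars b
ovars (modT a b)  = ovars a ++ ovars b
ovars (maxT a b)  = ovars a ++ ovars b
ovars (toNat a)   = ovars a
ovars (bvToNat a) = ovars a
ovars (fpLit x)   = []
ovars (fpAdd a b) = ovars a ++ ovars b
ovars (fpMul a b) = ovars a ++ ovars b
ovars (bvLit x)   = []
ovars (bvAdd a b) = ovars a ++ ovars b
ovars (bvMul a b) = ovars a ++ ovars b
ovars tt          = []
ovars ff          = []
ovars (notT a)    = ovars a
ovars (andT a b)  = ovars a ++ ovars b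
ovars (orT a b)   = ovars a ++ ovars b
ovars (eqT a b)   = ovars a ++ ovars b
ovars (leqT a b)  = ovars a ++ ovars b
ovars (geqT a b)  = ovars a ++ ovars b

pvars : ∀ {s} → Term s → List ℕ
pvars (var s i)   = []
pvars (pv w)      = w ∷ []
pvars (ite c a b) = pvars c ++ pvars a ++ pvars b
pvars (lit n)     = []
pvars (plus a b)  = pvars a ++ pvars b
pvars (times a b) = pvars a ++ pvars b
pvars (minus a b) = pvars a ++ pvars b
pvars (modT a b)  = pvars a ++ pvars b
pvars (maxT a b)  = pvars a ++ pvars b
pvars (toNat a)   = pvars a
pvars (bvToNat a) = pvars a
pvars (fpLit x)   = []
pvars (fpAdd a b) = pvars a ++ pvars b
pvars (fpMul a b) = pvars a ++ pvars b
pvars (bvLit x)   = []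
pvars (bvAdd a b) = pvars a ++ pvars b
pvars (bvMul a b) = pvars a ++ pvars b
pvars tt          = []
pvars ff          = []
pvars (notT a)    = pvars a
pvars (andT a b)  = pvars a ++ pvars b
pvars (orT a b)   = pvars a ++ pvars b
pvars (eqT a b)   = pvars a ++ pvars b
pvars (leqT a b)  = pvars a ++ pvars b
pvars (geqT a b)  = pvars a ++ pvars b

hasSubT : ∀ {s} → Term s → Bool
hasSubT (var s i)   = false
hasSubT (pv w)      = false
hasSubT (ite c a b) = hasSubT c ∨ hasSubT a ∨ hasSubT b
hasSubT (lit n)     = false
hasSubT (plus a b)  = hasSubT a ∨ hasSubT b
hasSubT (times a b) = hasSubT a ∨ hasSubT b
hasSubT (minus a b) = true
hasSubT (modT a b)  = hasSubT a ∨ hasSubT b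
hasSubT (maxT a b)  = hasSubT a ∨ hasSubT b
hasSubT (toNat a)   = hasSubT a
hasSubT (bvToNat a) = hasSubT a
hasSubT (fpLit x)   = false
hasSubT (fpAdd a b) = hasSubT a ∨ hasSubT b
hasSubT (fpMul a b) = hasSubT a ∨ hasSubT b
hasSubT (bvLit x)   = false
hasSubT (bvAdd a b) = hasSubT a ∨ hasSubT b
hasSubT (bvMul a b) = hasSubT a ∨ hasSubT b
hasSubT tt          = false
hasSubT ff          = false
hasSubT (notT a)    = hasSubT a
hasSubT (andT a b)  = hasSubT a ∨ hasSubT b
hasSubT (orT a b)   = hasSubT a ∨ hasSubT b
hasSubT (eqT a b)   = hasSubT a ∨ hasSubT b
hasSubT (leqT a b)  = hasSubT a ∨ hasSubT b
hasSubT (geqT a b)  = hasSubT a ∨ hasSubT b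

substPV : ∀ {s} → ℕ → Term nat → Term s → Term s
substPV w C (var s i)   = var s i
substPV w C (pv u)      = if u ≡ᵇ w then C else pv u
substPV w C (ite c a b) = ite (substPV w C c) (substPV w C a) (substPV w C b)
substPV w C (lit n)     = lit n
substPV w C (plus a b)  = plus (substPV w C a) (substPV w C b)
substPV w C (times a b) = times (substPV w C a) (substPV w C b)
substPV w C (minus a b) = minus (substPV w C a) (substPV w C b)
substPV w C (modT a b)  = modT (substPV w C a) (substPV w C b)
substPV w C (maxT a b)  = maxT (substPV w C a) (substPV w C b)
substPV w C (toNat a)   = toNat (substPV w C a)
substPV w C (bvToNat a) = bvToNat (substPV w C a)
substPV w C (fpLit x)   = fpLit x
substPV w C (fpAdd a b) = fpAdd (substPV w C a) (substPV w C b)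
substPV w C (fpMul a b) = fpMul (substPV w C a) (substPV w C b)
substPV w C (bvLit x)   = bvLit x
substPV w C (bvAdd a b) = bvAdd (substPV w C a) (substPV w C b)
substPV w C (bvMul a b) = bvMul (substPV w C a) (substPV w C b)
substPV w C tt          = tt
substPV w C ff          = ff
substPV w C (notT a)    = notT (substPV w C a)
substPV w C (andT a b)  = andT (substPV w C a) (substPV w C b)
substPV w C (orT a b)   = orT (substPV w C a) (substPV w C b)
substPV w C (eqT a b)   = eqT (substPV w C a) (substPV w C b)
substPV w C (leqT a b)  = leqT (substPV w C a) (substPV w C b)
substPV w C (geqT a b)  = geqT (substPV w C a) (substPV w C b)

substV : ∀ {s} → ℕ → ℕ → Term s → Term s
substV v n (var nat i)      = if i ≡ᵇ v then lit n else var nat i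
substV v n (var (fp P p) i) = var (fp P p) i
substV v n (var (bv N) i)   = var (bv N) i
substV v n (var bool i)     = var bool i
substV v n (pv u)           = pv u
substV v n (ite c a b)      = ite (substV v n c) (substV v n a) (substV v n b)
substV v n (lit m)          = lit m
substV v n (plus a b)       = plus (substV v n a) (substV v n b)
substV v n (times a b)      = times (substV v n a) (substV v n b)
substV v n (minus a b)      = minus (substV v n a) (substV v n b)
substV v n (modT a b)       = modT (substV v n a) (substV v n b)
substV v n (maxT a b)       = maxT (substV v n a) (substV v n b)
substV v n (toNat a)        = toNat (substV v n a)
substV v n (bvToNat a)      = bvToNat (substV v n a)
substV v n (fpLit x)        = fpLit x
substV v n (fpAdd a b)      = fpAdd (substV v n a) (substV v n b)
substV v n (fpMul a b)      = fpMul (substV v n a) (substV v n b)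
substV v n (bvLit x)        = bvLit x
substV v n (bvAdd a b)      = bvAdd (substV v n a) (substV v n b)
substV v n (bvMul a b)      = bvMul (substV v n a) (substV v n b)
substV v n tt               = tt
substV v n ff               = ff
substV v n (notT a)         = notT (substV v n a)
substV v n (andT a b)       = andT (substV v n a) (substV v n b)
substV v n (orT a b)        = orT (substV v n a) (substV v n b)
substV v n (eqT a b)        = eqT (substV v n a) (substV v n b)
substV v n (leqT a b)       = leqT (substV v n a) (substV v n b)
substV v n (geqT a b)       = geqT (substV v n a) (substV v n b)

HasVars : ∀ {s} → Term s → Set
HasVars t = ¬ (ovars t ≡ []) × (pvars t ≡ [])

IsConst : Term nat → Set
IsConst t = (ovars t ≡ []) × (pvars t ≡ [])

data Rel : Set where
  le ge : Rel

flipRel : Rel → Rel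
flipRel le = ge
flipRel ge = le

record Goal : Set where
  constructor goal
  field
    lhs : Term nat
    rel : Rel
    rhs : Term nat
open Goal public

Hyps : Set
Hyps = List (Term bool)

Goals : Set
Goals = List Goal

relFormula : Rel → Term nat → Term nat → Term bool
relFormula le a b = leqT a b
relFormula ge a b = geqT a b

relHolds : Rel → ℕ → ℕ → Set
relHolds le a b = a ≤ b
relHolds ge a b = a ≥ b

⟦_⟧ᵍ : Goal → Val → PVal → Set
⟦ goal a r b ⟧ᵍ ρ π = relHolds r (eval ρ π a) (eval ρ π b)

ovarsG : Goal → List OVar
ovarsG (goal a r b) = ovars a ++ ovars b

pvarsG : Goal → List ℕ
pvarsG (goal a r b) = pvars a ++ pvars b

hasSubG : Goal → Bool
hasSubG (goal a r b) = hasSubT a ∨ hasSubT b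

HasVarsG : Goal → Set
HasVarsG γ = ¬ (ovarsG γ ≡ []) × (pvarsG γ ≡ [])

substPVG : ℕ → Term nat → Goal → Goal
substPVG w C (goal a r b) = goal (substPV w C a) r (substPV w C b)

substVG : ℕ → ℕ → Goal → Goal
substVG v n (goal a r b) = goal (substV v n a) r (substV v n b)

TwoOrigVars : Goal → ℕ → ℕ → Set
TwoOrigVars γ v₁ v₂ =
  (v₁ ≢ v₂) × ((nat , v₁) ∈ ovarsG γ) × ((nat , v₂) ∈ ovarsG γ)
  × (∀ x → x ∈ ovarsG γ → (x ≡ (nat , v₁)) ⊎ (x ≡ (nat , v₂)))

-- Goal-set manipulations (goal sets are lists read as finite sets:
-- only membership matters)

Replace : Goals → Goal → Goals → Goals → Set
Replace G γ new G' =
  (γ ∈ G) × (∀ g → (g ∈ G') ⇔ (((g ∈ G) × (g ≢ γ)) ⊎ (g ∈ new)))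

Instantiate : Goals → Goal → ℕ → Term nat → Goals → Set
Instantiate G γ w C G' =
  (γ ∈ G) ×
  (∀ g → (g ∈ G') ⇔ (((g ∈ G) × (w ∉ pvarsG g))
                      ⊎ (∃[ γ' ] ((γ' ∈ G) × (γ' ≢ γ) × (g ≡ substPVG w C γ')))))

Fresh : Goals → ℕ → Set
Fresh G w = ∀ g → g ∈ G → w ∉ pvarsG g

data Step (H : Hyps) : Goals → Goals → Set where
  introPVar : ∀ {G G'} t₁ r t₂ w →
    HasVarsG (goal t₁ r t₂) → Fresh G w →
    Replace G (goal t₁ r t₂) (goal t₁ r (pv w) ∷ goal t₂ (flipRel r) (pv w) ∷ []) G' →
    Step H G G'
  leqAdd : ∀ {G G'} t₁ t₂ w w₁ w₂ →
    HasVars (plus t₁ t₂) → Fresh G w₁ → Fresh G w₂ → w₁ ≢ w₂ →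
    Replace G (goal (plus t₁ t₂) le (pv w))
      (goal t₁ le (pv w₁) ∷ goal t₂ le (pv w₂) ∷ goal (plus (pv w₁) (pv w₂)) le (pv w) ∷ []) G' →
    Step H G G'
  leqMul : ∀ {G G'} t₁ t₂ w w₁ w₂ →
    HasVars (times t₁ t₂) → Fresh G w₁ → Fresh G w₂ → w₁ ≢ w₂ →
    Replace G (goal (times t₁ t₂) le (pv w))
      (goal t₁ le (pv w₁) ∷ goal t₂ le (pv w₂) ∷ goal (times (pv w₁) (pv w₂)) le (pv w) ∷ []) G' →
    Step H G G'
  leqSub : ∀ {G G'} t₁ t₂ w →
    HasVars (minus t₁ t₂) →
    Replace G (goal (minus t₁ t₂) le (pv w)) (goal t₁ le (pv w) ∷ []) G' →
    Step H G G'
  leqMod : ∀ {G G'} t₁ t₂ w →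
    HasVars (modT t₁ t₂) →
    Replace G (goal (modT t₁ t₂) le (pv w)) (goal t₂ le (pv w) ∷ []) G' →
    Step H G G'
  leqIf : ∀ {G G'} c t₁ t₂ w w₁ w₂ →
    HasVars t₁ → HasVars t₂ → Fresh G w₁ → Fresh G w₂ → w₁ ≢ w₂ →
    Replace G (goal (ite c t₁ t₂) le (pv w))
      (goal t₁ le (pv w₁) ∷ goal t₂ le (pv w₂) ∷ goal (maxT (pv w₁) (pv w₂)) le (pv w) ∷ []) G' →
    Step H G G'
  ineqHyp : ∀ {G G'} t₁ r w C →
    HasVars t₁ → IsConst C → relFormula r t₁ C ∈ H →
    Instantiate G (goal t₁ r (pv w)) w C G' →
    Step H G G'
  leqZMod : ∀ {G G'} P pr i w →
    Instantiate G (goal (toNat (var (fp P pr) i)) le (pv w)) w (lit (P ∸ 1)) G' →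
    Step H G G'
  leqBV : ∀ {G G'} N i w →
    Instantiate G (goal (bvToNat (var (bv N) i)) le (pv w)) w (lit (2 ^ N ∸ 1)) G' →
    Step H G G'
  geNat : ∀ {G G'} t₁ w →
    HasVars t₁ →
    Instantiate G (goal t₁ ge (pv w)) w (lit 0) G' →
    Step H G G'
  ineqConst : ∀ {G G'} C r w →
    IsConst C →
    (∀ γ' → γ' ∈ G → (w ∉ pvarsG γ') ⊎ (ovarsG γ' ≡ [])) →
    Instantiate G (goal C r (pv w)) w C G' →
    Step H G G'
  -- eval: C₁ ≤ C₂ with C₁ C₂ constants is replaced by its truth value:
  -- a true goal is discharged, a false one becomes the goal 1 ≤ 0 (false).
  -- (Closed terms evaluate independently of the valuations ρ, π.)
  evalTrue : ∀ {G G'} C₁ C₂ →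
    IsConst C₁ → IsConst C₂ → (∀ ρ π → eval ρ π C₁ ≤ eval ρ π C₂) →
    Replace G (goal C₁ le C₂) [] G' →
    Step H G G'
  evalFalse : ∀ {G G'} C₁ C₂ →
    IsConst C₁ → IsConst C₂ → (∀ ρ π → ¬ (eval ρ π C₁ ≤ eval ρ π C₂)) →
    Replace G (goal C₁ le C₂) (goal (lit 1) le (lit 0) ∷ []) G' →
    Step H G G'
  ineqCases : ∀ {G G'} t₁ r t₂ v₁ v₂ →
    TwoOrigVars (goal t₁ r t₂) v₁ v₂ →
    (hasSubG (goal t₁ r t₂) ≡ true) ⊎ (HasVars t₁ × HasVars t₂) →
    leqT (var nat v₁) (lit 1) ∈ H → leqT (var nat v₂) (lit 1) ∈ H →
    Replace G (goal t₁ r t₂)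
      (  substVG v₂ 0 (substVG v₁ 0 (goal t₁ r t₂))
       ∷ substVG v₂ 1 (substVG v₁ 0 (goal t₁ r t₂))
       ∷ substVG v₂ 0 (substVG v₁ 1 (goal t₁ r t₂))
       ∷ substVG v₂ 1 (substVG v₁ 1 (goal t₁ r t₂)) ∷ []) G' →
    Step H G G'
  ineqXOR : ∀ {G G'} v₁ t₁ t₂ r w →
    leqT (var nat v₁) (lit 1) ∈ H →
    Replace G
      (goal (plus (times (var nat v₁) t₁) (times (minus (lit 1) (var nat v₁)) t₂)) r (pv w))
      (goal (ite (eqT (var nat v₁) (lit 0)) t₂ t₁) r (pv w) ∷ []) G' →
    Step H G G'

data Derivation (H : Hyps) : Goals → Goals → Set where
  done : ∀ {G} → Derivation H G G
  step : ∀ {G G₁ G'} → Step H G G₁ → Derivation H G₁ G' → Derivation H G G'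

NoPlaceholders : Goals → Hyps → Set
NoPlaceholders G H = (∀ g → g ∈ G → pvarsG g ≡ []) × (∀ h → h ∈ H → pvars h ≡ [])

_⊨_ : Hyps → Goal → Set
H ⊨ γ = ∀ (ρ : Val) (π : PVal) → (∀ h → h ∈ H → eval ρ π h ≡ true) → ⟦ γ ⟧ᵍ ρ π

{-# OPTIONS --safe #-}
module Submission where

-- Soundness is proved backwards along the derivation. Call a goal set valid
-- under H if every valuation of the original variables satisfying H extends
-- by some placeholder valuation satisfying all goals. Each rule reflects
-- validity: a replaced goal follows from its replacements by an arithmetic
-- fact (monotonicity of + and *, t₁ ∸ t₂ ≤ t₁, t₁ mod t₂ ≤ t₂, ...), and an
-- instantiation w := C is undone by giving w the value of C. The empty goal
-- set is valid, and for the placeholder-free initial context validity of G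
-- says exactly that H ⊨ γ for every γ ∈ G.

open import Defs
open import Data.Bool using (true; false; if_then_else_; not; _∧_; _∨_; T)
open import Data.Fin using (toℕ)
open import Data.Fin.Properties using (toℕ≤pred[n])
open import Data.List using ([]; _∷_; _++_)
open import Data.List.Properties using (++-conicalˡ; ++-conicalʳ)
open import Data.List.Membership.Propositional using (_∈_)
open import Data.List.Relation.Unary.Any using (here; there)
open import Data.Nat using (ℕ; zero; suc; _+_; _*_; _∸_; _≤_; _≡ᵇ_; _⊔_; z≤n; s≤s; _≤?_)
open import Data.Nat.Properties
  using (≤-refl; ≤-trans; +-mono-≤; *-mono-≤; ⊔-mono-≤; m≤m⊔n; m≤n⊔m; m∸n≤m; +-identityʳ; ≡ᵇ⇒≡; ≡⇒≡ᵇ)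
open import Data.Nat.DivMod using (m%n≤n)
open import Data.Product using (_,_; proj₁; proj₂; ∃-syntax)
open import Data.Sum using (inj₁; inj₂)
open import Function.Base using (id; _∘_)
open import Function.Bundles using (Equivalence)
open import Relation.Nullary using (¬_; Dec; contradiction)
open import Relation.Nullary.Decidable using (decidable-stable)
open import Relation.Binary.PropositionalEquality

_[_≔_] : PVal → ℕ → ℕ → PVal
(π [ w ≔ x ]) u = if u ≡ᵇ w then x else π u

[≔]-self : ∀ π w x → (π [ w ≔ x ]) w ≡ x
[≔]-self π w x with w ≡ᵇ w | ≡⇒≡ᵇ w w refl
... | true  | _  = refl
... | false | ()

module _ (ρ : Val) (π π′ : PVal) where

  eval-pvar-free : ∀ {s} (t : Term s) → pvars t ≡ [] → eval ρ π t ≡ eval ρ π′ t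

  eval-pvar-free₂ : ∀ {s s′} {A : Set} (f : ⟦ s ⟧ˢ → ⟦ s′ ⟧ˢ → A) (a : Term s) (b : Term s′) →
                    pvars a ++ pvars b ≡ [] → f (eval ρ π a) (eval ρ π b) ≡ f (eval ρ π′ a) (eval ρ π′ b)
  eval-pvar-free₂ f a b p =
    cong₂ f (eval-pvar-free a (++-conicalˡ _ _ p)) (eval-pvar-free b (++-conicalʳ _ _ p))

  eval-pvar-free (var s i)     p = refl
  eval-pvar-free (ite c a b)   p rewrite eval-pvar-free c (++-conicalˡ _ _ p) =
    eval-pvar-free₂ (λ x y → if eval ρ π′ c then x else y) a b (++-conicalʳ (pvars c) _ p)
  eval-pvar-free (lit n)       p = refl
  eval-pvar-free (plus a b)    p = eval-pvar-free₂ _+_ a b p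
  eval-pvar-free (times a b)   p = eval-pvar-free₂ _*_ a b p
  eval-pvar-free (minus a b)   p = eval-pvar-free₂ _∸_ a b p
  eval-pvar-free (modT a b)    p = eval-pvar-free₂ modℕ a b p
  eval-pvar-free (maxT a b)    p = eval-pvar-free₂ _⊔_ a b p
  eval-pvar-free (toNat a)     p = cong toℕ (eval-pvar-free a p)
  eval-pvar-free (bvToNat a)   p = cong toℕ (eval-pvar-free a p)
  eval-pvar-free (fpLit x)     p = refl
  eval-pvar-free (fpAdd a b)   p = eval-pvar-free₂ addF a b p
  eval-pvar-free (fpMul a b)   p = eval-pvar-free₂ mulF a b p
  eval-pvar-free (bvLit x)     p = refl
  eval-pvar-free (bvAdd a b)   p = eval-pvar-free₂ addF a b p
  eval-pvar-free (bvMul a b)   p = eval-pvar-free₂ mulF a b p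
  eval-pvar-free tt            p = refl
  eval-pvar-free ff            p = refl
  eval-pvar-free (notT a)      p = cong not (eval-pvar-free a p)
  eval-pvar-free (andT a b)    p = eval-pvar-free₂ _∧_ a b p
  eval-pvar-free (orT a b)     p = eval-pvar-free₂ _∨_ a b p
  eval-pvar-free (eqT {s} a b) p = eval-pvar-free₂ (eqˢ s) a b p
  eval-pvar-free (leqT a b)    p = eval-pvar-free₂ leqᵇ a b p
  eval-pvar-free (geqT a b)    p = eval-pvar-free₂ (λ x y → leqᵇ y x) a b p

module _ (ρ : Val) (π : PVal) (w : ℕ) (C : Term nat) where

  eval-substPV : ∀ {s} (t : Term s) → eval ρ π (substPV w C t) ≡ eval ρ (π [ w ≔ eval ρ π C ]) t
  eval-substPV (var s i)     = refl
  eval-substPV (pv u) with u ≡ᵇ w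
  ... | true  = refl
  ... | false = refl
  eval-substPV (ite c a b) rewrite eval-substPV c | eval-substPV a | eval-substPV b = refl
  eval-substPV (lit n)       = refl
  eval-substPV (plus a b)    = cong₂ _+_ (eval-substPV a) (eval-substPV b)
  eval-substPV (times a b)   = cong₂ _*_ (eval-substPV a) (eval-substPV b)
  eval-substPV (minus a b)   = cong₂ _∸_ (eval-substPV a) (eval-substPV b)
  eval-substPV (modT a b)    = cong₂ modℕ (eval-substPV a) (eval-substPV b)
  eval-substPV (maxT a b)    = cong₂ _⊔_ (eval-substPV a) (eval-substPV b)
  eval-substPV (toNat a)     = cong toℕ (eval-substPV a)
  eval-substPV (bvToNat a)   = cong toℕ (eval-substPV a)
  eval-substPV (fpLit x)     = refl
  eval-substPV (fpAdd a b)   = cong₂ addF (eval-substPV a) (eval-substPV b)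
  eval-substPV (fpMul a b)   = cong₂ mulF (eval-substPV a) (eval-substPV b)
  eval-substPV (bvLit x)     = refl
  eval-substPV (bvAdd a b)   = cong₂ addF (eval-substPV a) (eval-substPV b)
  eval-substPV (bvMul a b)   = cong₂ mulF (eval-substPV a) (eval-substPV b)
  eval-substPV tt            = refl
  eval-substPV ff            = refl
  eval-substPV (notT a)      = cong not (eval-substPV a)
  eval-substPV (andT a b)    = cong₂ _∧_ (eval-substPV a) (eval-substPV b)
  eval-substPV (orT a b)     = cong₂ _∨_ (eval-substPV a) (eval-substPV b)
  eval-substPV (eqT {s} a b) = cong₂ (eqˢ s) (eval-substPV a) (eval-substPV b)
  eval-substPV (leqT a b)    = cong₂ leqᵇ (eval-substPV a) (eval-substPV b)
  eval-substPV (geqT a b)    = cong₂ leqᵇ (eval-substPV b) (eval-substPV a)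

module _ (ρ : Val) (π : PVal) {v n : ℕ} (ρv≡n : ρ nat v ≡ n) where

  eval-substV : ∀ {s} (t : Term s) → eval ρ π (substV v n t) ≡ eval ρ π t
  eval-substV (var nat i) with i ≡ᵇ v in i≡ᵇv
  ... | true rewrite ≡ᵇ⇒≡ i v (subst T (sym i≡ᵇv) _) = sym ρv≡n
  ... | false = refl
  eval-substV (var (fp P pr) i) = refl
  eval-substV (var (bv N) i)    = refl
  eval-substV (var bool i)      = refl
  eval-substV (pv u)            = refl
  -- substV inspects the sort before the term, so ite computes only at a known sort
  eval-substV {fp P pr} (ite c a b) rewrite eval-substV c | eval-substV a | eval-substV b = refl
  eval-substV {nat}     (ite c a b) rewrite eval-substV c | eval-substV a | eval-substV b = refl
  eval-substV {bv N}    (ite c a b) rewrite eval-substV c | eval-substV a | eval-substV b = refl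
  eval-substV {bool}    (ite c a b) rewrite eval-substV c | eval-substV a | eval-substV b = refl
  eval-substV (lit m)           = refl
  eval-substV (plus a b)        = cong₂ _+_ (eval-substV a) (eval-substV b)
  eval-substV (times a b)       = cong₂ _*_ (eval-substV a) (eval-substV b)
  eval-substV (minus a b)       = cong₂ _∸_ (eval-substV a) (eval-substV b)
  eval-substV (modT a b)        = cong₂ modℕ (eval-substV a) (eval-substV b)
  eval-substV (maxT a b)        = cong₂ _⊔_ (eval-substV a) (eval-substV b)
  eval-substV (toNat a)         = cong toℕ (eval-substV a)
  eval-substV (bvToNat a)       = cong toℕ (eval-substV a)
  eval-substV (fpLit x)         = refl
  eval-substV (fpAdd a b)       = cong₂ addF (eval-substV a) (eval-substV b)
  eval-substV (fpMul a b)       = cong₂ mulF (eval-substV a) (eval-substV b)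
  eval-substV (bvLit x)         = refl
  eval-substV (bvAdd a b)       = cong₂ addF (eval-substV a) (eval-substV b)
  eval-substV (bvMul a b)       = cong₂ mulF (eval-substV a) (eval-substV b)
  eval-substV tt                = refl
  eval-substV ff                = refl
  eval-substV (notT a)          = cong not (eval-substV a)
  eval-substV (andT a b)        = cong₂ _∧_ (eval-substV a) (eval-substV b)
  eval-substV (orT a b)         = cong₂ _∨_ (eval-substV a) (eval-substV b)
  eval-substV (eqT {s} a b)     = cong₂ (eqˢ s) (eval-substV a) (eval-substV b)
  eval-substV (leqT a b)        = cong₂ leqᵇ (eval-substV a) (eval-substV b)
  eval-substV (geqT a b)        = cong₂ leqᵇ (eval-substV b) (eval-substV a)

⟦⟧ᵍ-pvar-free : ∀ g → pvarsG g ≡ [] → ∀ ρ π π′ → ⟦ g ⟧ᵍ ρ π → ⟦ g ⟧ᵍ ρ π′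
⟦⟧ᵍ-pvar-free (goal a r b) p ρ π π′ =
  subst₂ (relHolds r) (eval-pvar-free ρ π π′ a (++-conicalˡ _ _ p)) (eval-pvar-free ρ π π′ b (++-conicalʳ _ _ p))

⟦⟧ᵍ-substPVG : ∀ w C g ρ π → ⟦ substPVG w C g ⟧ᵍ ρ π → ⟦ g ⟧ᵍ ρ (π [ w ≔ eval ρ π C ])
⟦⟧ᵍ-substPVG w C (goal a r b) ρ π = subst₂ (relHolds r) (eval-substPV ρ π w C a) (eval-substPV ρ π w C b)

⟦⟧ᵍ-substVG : ∀ {v n} g ρ π → ρ nat v ≡ n → ⟦ substVG v n g ⟧ᵍ ρ π → ⟦ g ⟧ᵍ ρ π
⟦⟧ᵍ-substVG (goal a r b) ρ π ρv≡n = subst₂ (relHolds r) (eval-substV ρ π ρv≡n a) (eval-substV ρ π ρv≡n b)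

relHolds? : ∀ r x y → Dec (relHolds r x y)
relHolds? le x y = x ≤? y
relHolds? ge x y = y ≤? x

⟦⟧ᵍ-stable : ∀ g ρ π → ¬ ¬ ⟦ g ⟧ᵍ ρ π → ⟦ g ⟧ᵍ ρ π
⟦⟧ᵍ-stable (goal a r b) ρ π = decidable-stable (relHolds? r _ _)

relHolds-refl : ∀ r x → relHolds r x x
relHolds-refl le x = ≤-refl
relHolds-refl ge x = ≤-refl

relHolds-trans-flip : ∀ r {x y z} → relHolds r x z → relHolds (flipRel r) y z → relHolds r x y
relHolds-trans-flip le x≤z y≥z = ≤-trans x≤z y≥z
relHolds-trans-flip ge x≥z y≤z = ≤-trans y≤z x≥z

leqᵇ⇒≤ : ∀ m n → leqᵇ m n ≡ true → m ≤ n
leqᵇ⇒≤ zero    n       _ = z≤n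
leqᵇ⇒≤ (suc m) (suc n) p = s≤s (leqᵇ⇒≤ m n p)

relFormula-sound : ∀ r a b ρ π → eval ρ π (relFormula r a b) ≡ true → relHolds r (eval ρ π a) (eval ρ π b)
relFormula-sound le a b ρ π = leqᵇ⇒≤ _ _
relFormula-sound ge a b ρ π = leqᵇ⇒≤ _ _

modℕ-≤ : ∀ m n → modℕ m n ≤ n
modℕ-≤ m zero    = z≤n
modℕ-≤ m (suc n) = m%n≤n m (suc n)

if-≤-⊔ : ∀ c (x y : ℕ) → (if c then x else y) ≤ x ⊔ y
if-≤-⊔ true  x y = m≤m⊔n x y
if-≤-⊔ false x y = m≤n⊔m x y

≤1⇒mix≡if : ∀ {x} → x ≤ 1 → ∀ a b → x * a + (1 ∸ x) * b ≡ (if x ≡ᵇ 0 then b else a)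
≤1⇒mix≡if z≤n       a b = +-identityʳ b
≤1⇒mix≡if (s≤s z≤n) a b = trans (+-identityʳ (a + 0)) (+-identityʳ a)

zeroOneInstances : Goal → ℕ → ℕ → Goals
zeroOneInstances γ v₁ v₂ =
    substVG v₂ 0 (substVG v₁ 0 γ)
  ∷ substVG v₂ 1 (substVG v₁ 0 γ)
  ∷ substVG v₂ 0 (substVG v₁ 1 γ)
  ∷ substVG v₂ 1 (substVG v₁ 1 γ) ∷ []

pattern 1st = here refl
pattern 2nd = there 1st
pattern 3rd = there 2nd
pattern 4th = there 3rd

∈-zeroOneInstances : ∀ γ v₁ v₂ {a b} → a ≤ 1 → b ≤ 1 → substVG v₂ b (substVG v₁ a γ) ∈ zeroOneInstances γ v₁ v₂
∈-zeroOneInstances γ v₁ v₂ z≤n       z≤n       = 1st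
∈-zeroOneInstances γ v₁ v₂ z≤n       (s≤s z≤n) = 2nd
∈-zeroOneInstances γ v₁ v₂ (s≤s z≤n) z≤n       = 3rd
∈-zeroOneInstances γ v₁ v₂ (s≤s z≤n) (s≤s z≤n) = 4th

AllHold : Goals → Val → PVal → Set
AllHold G ρ π = ∀ g → g ∈ G → ⟦ g ⟧ᵍ ρ π

-- Hypotheses are read under every placeholder valuation; for the
-- placeholder-free H of the theorem this is the ordinary reading.
HypsHold : Hyps → Val → Set
HypsHold H ρ = ∀ π h → h ∈ H → eval ρ π h ≡ true

Valid : Hyps → Goals → Set
Valid H G = ∀ ρ → HypsHold H ρ → ∃[ π ] AllHold G ρ π

Valid-[] : ∀ {H} → Valid H []
Valid-[] _ _ = (λ _ → 0) , λ _ ()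

-- Goal equality is undecidable (sorts carry primality proofs), so the
-- case split g ≡ γ is replaced by one on the truth of g.
replace-sound : ∀ {H G γ new G′} → Replace G γ new G′ →
                (∀ ρ π → HypsHold H ρ → AllHold new ρ π → ⟦ γ ⟧ᵍ ρ π) →
                Valid H G′ → Valid H G
replace-sound {G = G} {γ} (_ , ∈G′⇔) new⇒γ valid ρ hyps with valid ρ hyps
... | π , G′-holds = π , G-holds
  where
  γ-holds : ⟦ γ ⟧ᵍ ρ π
  γ-holds = new⇒γ ρ π hyps λ g g∈new → G′-holds g (Equivalence.from (∈G′⇔ g) (inj₂ g∈new))

  G-holds : AllHold G ρ π
  G-holds g g∈G = ⟦⟧ᵍ-stable g ρ π λ ¬g →
    ¬g (G′-holds g (Equivalence.from (∈G′⇔ g) (inj₁ (g∈G , λ { refl → ¬g γ-holds }))))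

instantiate-sound : ∀ {H G t r w C G′} → pvars t ≡ [] → Instantiate G (goal t r (pv w)) w C G′ →
                    (∀ ρ π → HypsHold H ρ → relHolds r (eval ρ π t) (eval ρ π C)) →
                    Valid H G′ → Valid H G
instantiate-sound {G = G} {t} {r} {w} {C} t-free (_ , ∈G′⇔) t⋈C valid ρ hyps with valid ρ hyps
... | π , G′-holds = π′ , G-holds
  where
  π′ : PVal
  π′ = π [ w ≔ eval ρ π C ]

  γ-holds : ⟦ goal t r (pv w) ⟧ᵍ ρ π′
  γ-holds = subst₂ (relHolds r) (eval-pvar-free ρ π π′ t t-free) (sym ([≔]-self π w _)) (t⋈C ρ π hyps)

  G-holds : AllHold G ρ π′
  G-holds g g∈G = ⟦⟧ᵍ-stable g ρ π′ λ ¬g → ¬g (⟦⟧ᵍ-substPVG w C g ρ π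
    (G′-holds _ (Equivalence.from (∈G′⇔ _) (inj₂ (g , g∈G , (λ { refl → ¬g γ-holds }) , refl)))))

step-sound : ∀ {H G G′} → Step H G G′ → Valid H G′ → Valid H G
step-sound (introPVar _ r _ _ _ _ rep) = replace-sound rep λ _ _ _ new →
  relHolds-trans-flip r (new _ 1st) (new _ 2nd)
step-sound (leqAdd _ _ _ _ _ _ _ _ _ rep) = replace-sound rep λ _ _ _ new →
  ≤-trans (+-mono-≤ (new _ 1st) (new _ 2nd)) (new _ 3rd)
step-sound (leqMul _ _ _ _ _ _ _ _ _ rep) = replace-sound rep λ _ _ _ new →
  ≤-trans (*-mono-≤ (new _ 1st) (new _ 2nd)) (new _ 3rd)
step-sound (leqSub t₁ t₂ _ _ rep) = replace-sound rep λ ρ π _ new →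
  ≤-trans (m∸n≤m (eval ρ π t₁) (eval ρ π t₂)) (new _ 1st)
step-sound (leqMod _ _ _ _ rep) = replace-sound rep λ _ _ _ new →
  ≤-trans (modℕ-≤ _ _) (new _ 1st)
step-sound (leqIf c _ _ _ _ _ _ _ _ _ _ rep) = replace-sound rep λ ρ π _ new →
  ≤-trans (if-≤-⊔ (eval ρ π c) _ _) (≤-trans (⊔-mono-≤ (new _ 1st) (new _ 2nd)) (new _ 3rd))
step-sound (ineqHyp t r _ C t-vars _ t⋈C∈H inst) = instantiate-sound (proj₂ t-vars) inst λ ρ π hyps →
  relFormula-sound r t C ρ π (hyps π _ t⋈C∈H)
step-sound (leqZMod P pr i _ inst) = instantiate-sound refl inst λ ρ _ _ → toℕ≤pred[n] (ρ (fp P pr) i)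
step-sound (leqBV N i _ inst) = instantiate-sound refl inst λ ρ _ _ → toℕ≤pred[n] (ρ (bv N) i)
step-sound (geNat _ _ t-vars inst) = instantiate-sound (proj₂ t-vars) inst λ _ _ _ → z≤n
step-sound (ineqConst _ r _ C-const _ inst) = instantiate-sound (proj₂ C-const) inst λ _ _ _ →
  relHolds-refl r _
step-sound (evalTrue _ _ _ _ C₁≤C₂ rep) = replace-sound rep λ ρ π _ _ → C₁≤C₂ ρ π
step-sound (evalFalse _ _ _ _ _ rep) = replace-sound rep λ _ _ _ new → contradiction (new _ 1st) λ ()
step-sound (ineqCases t₁ r t₂ v₁ v₂ _ _ v₁≤1∈H v₂≤1∈H rep) = replace-sound rep λ ρ π hyps new →
  let γ = goal t₁ r t₂ in
  ⟦⟧ᵍ-substVG γ ρ π refl (⟦⟧ᵍ-substVG (substVG v₁ _ γ) ρ π refl (new _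
    (∈-zeroOneInstances γ v₁ v₂ (leqᵇ⇒≤ _ _ (hyps π _ v₁≤1∈H)) (leqᵇ⇒≤ _ _ (hyps π _ v₂≤1∈H)))))
step-sound (ineqXOR v₁ _ _ r w v₁≤1∈H rep) = replace-sound rep λ ρ π hyps new →
  subst (λ x → relHolds r x (π w)) (sym (≤1⇒mix≡if (leqᵇ⇒≤ (ρ nat v₁) 1 (hyps π _ v₁≤1∈H)) _ _)) (new _ 1st)

derivation-sound : ∀ {H G G′} → Derivation H G G′ → Valid H G′ → Valid H G
derivation-sound done       = id
derivation-sound (step s d) = step-sound s ∘ derivation-sound d

theorem4 : (G : Goals) (H : Hyps) → NoPlaceholders G H →
           Derivation H G [] → ∀ γ → γ ∈ G → H ⊨ γ
theorem4 G H (G-pvar-free , H-pvar-free) derivation γ γ∈G ρ π hyps =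
  ⟦⟧ᵍ-pvar-free γ (G-pvar-free γ γ∈G) ρ (proj₁ G-valid) π (proj₂ G-valid γ γ∈G)
  where
  G-valid : ∃[ π′ ] AllHold G ρ π′
  G-valid = derivation-sound derivation Valid-[] ρ λ π′ h h∈H →
    trans (eval-pvar-free ρ π′ π h (H-pvar-free h h∈H)) (hyps h h∈H)
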